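{- Let $G$ be a clock-free graph and let $P$ be an induced path in $G$. Let $a$ be an end of $P$ and let $y$ be the neighbour of $a$ in $P$. Let $x,v\in N(a)$ be such that $\{x,y,v\}$ is a stable set. Then at least one of $x$ and $v$ has no neighbour in $P\setminus\{a\}$.
   Context: A hole is an induced cycle on at least four vertices; a clock is a hole $C$ together with a vertex $v\notin C$ whose neighbours in $C$ include two non-adjacent vertices; clock-free means no induced clock. -}

module Defs where

open import Level using (0ℓ)
open import Data.Nat using (ℕ; zero; suc; _≤_)
open import Data.Fin using (Fin; toℕ)
open import Data.Product using (Σ; _×_; _,_; ∃)
open import Data.Sum using (_⊎_)
open import Relation.Nullary using (¬_; Dec)
open import Relation.Binary.PropositionalEquality using (_≡_; _≢_)
open import Function.Definitions using (Injective)
open import Function.Bundles using (_⇔_)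

record Graph (n : ℕ) : Set₁ where
  field
    Adj     : Fin n → Fin n → Set
    adj?    : ∀ u v → Dec (Adj u v)
    sym     : ∀ {u v} → Adj u v → Adj v u
    irrefl  : ∀ {u} → ¬ Adj u u

module _ {n : ℕ} (G : Graph n) where
  open Graph G

  PathAdj : {m : ℕ} → Fin m → Fin m → Set
  PathAdj i j = (toℕ j ≡ suc (toℕ i)) ⊎ (toℕ i ≡ suc (toℕ j))

  CycAdj : {k : ℕ} → Fin k → Fin k → Set
  CycAdj {k} i j = PathAdj i j
                 ⊎ ((toℕ i ≡ 0 × suc (toℕ j) ≡ k) ⊎ (toℕ j ≡ 0 × suc (toℕ i) ≡ k))

  IsInducedPath : {m : ℕ} → (Fin m → Fin n) → Set
  IsInducedPath {m} p = Injective _≡_ _≡_ p × (∀ i j → Adj (p i) (p j) ⇔ PathAdj i j)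

  IsHole : {k : ℕ} → (Fin k → Fin n) → Set
  IsHole {k} c = (4 ≤ k) × Injective _≡_ _≡_ c × (∀ i j → Adj (c i) (c j) ⇔ CycAdj i j)

  record Clock : Set where
    field
      k    : ℕ
      c    : Fin k → Fin n
      hole : IsHole c
      w    : Fin n
      w∉C  : ∀ i → c i ≢ w
      i j  : Fin k
      i≢j  : i ≢ j
      wci  : Adj w (c i)
      wcj  : Adj w (c j)
      nonadj : ¬ Adj (c i) (c j)

  ClockFree : Set
  ClockFree = ¬ Clock

  HasNbrInPathMinus : {m : ℕ} → (Fin m → Fin n) → Fin n → Fin n → Set
  HasNbrInPathMinus p a x = ∃ λ i → (p i ≢ a) × Adj x (p i)

-- Suppose both x and v have neighbours on P beyond a, and let pᵢ and pⱼ be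
-- the first such neighbours of x and of v, say i ≤ j. Since neither sees
-- y = p₁ we have i, j ≥ 2, so v together with the subpath p₀ … pⱼ is a hole.
-- The vertex x lies off this hole and sees its two non-adjacent vertices
-- p₀ and pᵢ, so we have found a clock. The other end of P is handled by
-- reversing P.
module Submission where

open import Level using (0ℓ)
open import Defs
open import Data.Nat using (ℕ; zero; suc; _≤_; _<_; _∸_; z≤n; s≤s; s≤s⁻¹; _<?_)
open import Data.Nat.Properties using (≤-total; +-∸-assoc; m≤n⇒m<n∨m≡n; <-irrefl)
  renaming (suc-injective to ℕ-suc-injective)
open import Data.Fin using (Fin; zero; suc; toℕ; fromℕ; fromℕ<; inject₁; inject≤; opposite)
open import Data.Fin.Properties
  using (toℕ-injective; toℕ<n; toℕ-fromℕ; toℕ-fromℕ<; toℕ-inject; toℕ-inject≤;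
         inject≤-injective; ≤∧≢⇒<; opposite-prop; opposite-involutive; ¬∀⟶∃¬-smallest; any?; _≟_)
  renaming (suc-injective to Fin-suc-injective)
open import Data.Product using (_×_; _,_; ∃; proj₂)
open import Data.Sum using (_⊎_; inj₁; inj₂)
import Data.Sum as Sum
open import Data.Vec.Functional using (_∷_)
open import Function using (_∘_; _⇔_; mk⇔; Equivalence)
open import Function.Construct.Composition using (_⇔-∘_)
open import Function.Construct.Symmetry using (⇔-sym)
open import Function.Definitions using (Injective)
open import Relation.Nullary using (¬_; Dec; yes; no; ¬?; contradiction)
open import Relation.Nullary.Decidable using (decidable-stable; _×-dec_)
open import Relation.Unary using (Pred; Decidable; ∁)
open import Relation.Binary.PropositionalEquality
  using (_≡_; _≢_; refl; sym; trans; cong; subst; subst₂; module ≡-Reasoning)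

least-witness : ∀ {k} (P : Pred (Fin k) 0ℓ) → Decidable P → ∃ P →
                ∃ λ i → P i × (∀ j → toℕ j < toℕ i → ¬ P j)
least-witness P P? (i₀ , Pi₀)
  with ¬∀⟶∃¬-smallest _ (∁ P) (¬? ∘ P?) (λ ∀¬P → ∀¬P i₀ Pi₀)
... | i , ¬¬Pi , ¬P-below = i , decidable-stable (P? i) ¬¬Pi , ¬P-before
  where
  ¬P-before : ∀ j → toℕ j < toℕ i → ¬ P j
  ¬P-before j j<i = subst (∁ P) (toℕ-injective (trans (toℕ-inject _) (toℕ-fromℕ< j<i)))
                              (¬P-below (fromℕ< j<i))

toℕ-opposite-suc : ∀ {k} {i j : Fin k} → toℕ j ≡ suc (toℕ i) →
                   toℕ (opposite i) ≡ suc (toℕ (opposite j))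
toℕ-opposite-suc {k} {i} {j} j≡1+i = begin
  toℕ (opposite i)       ≡⟨ opposite-prop i ⟩
  k ∸ suc (toℕ i)        ≡⟨ cong (k ∸_) j≡1+i ⟨
  k ∸ toℕ j              ≡⟨ +-∸-assoc 1 (toℕ<n j) ⟩
  suc (k ∸ suc (toℕ j))  ≡⟨ cong suc (opposite-prop j) ⟨
  suc (toℕ (opposite j)) ∎
  where open ≡-Reasoning

module _ {n : ℕ} (G : Graph n) where
  open Graph G using (Adj; adj?; irrefl) renaming (sym to Adj-sym)

  Adj-comm : ∀ {u w} → Adj u w ⇔ Adj w u
  Adj-comm = mk⇔ Adj-sym Adj-sym

  PathAdj-toℕ : ∀ {k l} {i j : Fin k} {i′ j′ : Fin l} →
                toℕ i ≡ toℕ i′ → toℕ j ≡ toℕ j′ → PathAdj G i j → PathAdj G i′ j′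
  PathAdj-toℕ eᵢ eⱼ (inj₁ e) = inj₁ (trans (sym eⱼ) (trans e (cong suc eᵢ)))
  PathAdj-toℕ eᵢ eⱼ (inj₂ e) = inj₂ (trans (sym eᵢ) (trans e (cong suc eⱼ)))

  PathAdj-opposite : ∀ {k} {i j : Fin k} → PathAdj G i j → PathAdj G (opposite i) (opposite j)
  PathAdj-opposite (inj₁ e) = inj₂ (toℕ-opposite-suc e)
  PathAdj-opposite (inj₂ e) = inj₁ (toℕ-opposite-suc e)

  CycAdj-comm : ∀ {k} {i j : Fin k} → CycAdj G i j ⇔ CycAdj G j i
  CycAdj-comm = mk⇔ swap swap
    where
    swap : ∀ {k} {i j : Fin k} → CycAdj G i j → CycAdj G j i
    swap (inj₁ (inj₁ e)) = inj₁ (inj₂ e)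
    swap (inj₁ (inj₂ e)) = inj₁ (inj₁ e)
    swap (inj₂ (inj₁ e)) = inj₂ (inj₂ e)
    swap (inj₂ (inj₂ e)) = inj₂ (inj₁ e)

  CycAdj-suc : ∀ {k} {i j : Fin (suc k)} → CycAdj G (suc i) (suc j) ⇔ PathAdj G i j
  CycAdj-suc = mk⇔ to from
    where
    to : ∀ {k} {i j : Fin (suc k)} → CycAdj G (suc i) (suc j) → PathAdj G i j
    to (inj₁ (inj₁ e)) = inj₁ (ℕ-suc-injective e)
    to (inj₁ (inj₂ e)) = inj₂ (ℕ-suc-injective e)
    to (inj₂ (inj₁ (() , _)))
    to (inj₂ (inj₂ (() , _)))
    from : ∀ {k} {i j : Fin (suc k)} → PathAdj G i j → CycAdj G (suc i) (suc j)
    from (inj₁ e) = inj₁ (inj₁ (cong suc e))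
    from (inj₂ e) = inj₁ (inj₂ (cong suc e))

  CycAdj-zero-suc : ∀ {k} {j : Fin (suc k)} →
                    CycAdj G zero (suc j) ⇔ (toℕ j ≡ 0 ⊎ toℕ j ≡ k)
  CycAdj-zero-suc = mk⇔ to from
    where
    to : ∀ {k} {j : Fin (suc k)} → CycAdj G zero (suc j) → toℕ j ≡ 0 ⊎ toℕ j ≡ k
    to (inj₁ (inj₁ e)) = inj₁ (ℕ-suc-injective e)
    to (inj₂ (inj₁ (_ , e))) = inj₂ (ℕ-suc-injective (ℕ-suc-injective e))
    from : ∀ {k} {j : Fin (suc k)} → toℕ j ≡ 0 ⊎ toℕ j ≡ k → CycAdj G zero (suc j)
    from (inj₁ e) = inj₁ (inj₁ (cong suc e))
    from (inj₂ e) = inj₂ (inj₁ (refl , cong (λ t → suc (suc t)) e))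

  HasNbrInPathMinus-reverse : ∀ {k} {p : Fin k → Fin n} {a x} →
                              HasNbrInPathMinus G p a x → HasNbrInPathMinus G (p ∘ opposite) a x
  HasNbrInPathMinus-reverse {p = p} {a} {x} (i , pᵢ≢a , x~pᵢ) =
    opposite i , subst (λ j → p j ≢ a × Adj x (p j)) (sym (opposite-involutive i)) (pᵢ≢a , x~pᵢ)

  reverse-isInducedPath : ∀ {k} {p : Fin k → Fin n} →
                          IsInducedPath G p → IsInducedPath G (p ∘ opposite)
  reverse-isInducedPath (p-inj , p-adj) =
    (λ e → opposite-injective (p-inj e)) ,
    λ i j → PathAdj-opposite⇔ i j ⇔-∘ p-adj (opposite i) (opposite j)
    where
    opposite-injective : ∀ {k} {i j : Fin k} → opposite i ≡ opposite j → i ≡ j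
    opposite-injective {i = i} {j} e =
      trans (sym (opposite-involutive i)) (trans (cong opposite e) (opposite-involutive j))
    PathAdj-opposite⇔ : ∀ {k} (i j : Fin k) →
                        PathAdj G (opposite i) (opposite j) ⇔ PathAdj G i j
    PathAdj-opposite⇔ i j =
      mk⇔ (subst₂ (PathAdj G) (opposite-involutive i) (opposite-involutive j) ∘ PathAdj-opposite)
          PathAdj-opposite

  prefix-isInducedPath : ∀ {k l} {p : Fin l → Fin n} (k≤l : k ≤ l) →
                         IsInducedPath G p → IsInducedPath G (λ i → p (inject≤ i k≤l))
  prefix-isInducedPath k≤l (p-inj , p-adj) =
    (λ e → inject≤-injective k≤l k≤l _ _ (p-inj e)) ,
    λ i j → mk⇔ (PathAdj-toℕ (toℕ-inject≤ i k≤l) (toℕ-inject≤ j k≤l))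
                (PathAdj-toℕ (sym (toℕ-inject≤ i k≤l)) (sym (toℕ-inject≤ j k≤l)))
            ⇔-∘ p-adj (inject≤ i k≤l) (inject≤ j k≤l)

  attach-isHole : ∀ {k} {q : Fin (suc k) → Fin n} {u} → IsInducedPath G q → 2 ≤ k →
                  (∀ i → q i ≢ u) → Adj u (q zero) → Adj u (q (fromℕ k)) →
                  (∀ i → 0 < toℕ i → toℕ i < k → ¬ Adj u (q i)) →
                  IsHole G (u ∷ q)
  attach-isHole {k} {q} {u} (q-inj , q-adj) 2≤k q∌u u~q₀ u~qₖ u≁inner =
    s≤s (s≤s 2≤k) , ∷-injective , ∷-adj
    where
    ∷-injective : Injective _≡_ _≡_ (u ∷ q)
    ∷-injective {zero}  {zero}  _ = refl
    ∷-injective {zero}  {suc j} e = contradiction (sym e) (q∌u j)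
    ∷-injective {suc i} {zero}  e = contradiction e (q∌u i)
    ∷-injective {suc i} {suc j} e = cong suc (q-inj e)

    ends : ∀ j → Adj u (q j) → toℕ j ≡ 0 ⊎ toℕ j ≡ k
    ends zero    _ = inj₁ refl
    ends (suc j) u~qⱼ with m≤n⇒m<n∨m≡n (s≤s⁻¹ (toℕ<n (suc j)))
    ... | inj₁ j<k = contradiction u~qⱼ (u≁inner (suc j) (s≤s z≤n) j<k)
    ... | inj₂ j≡k = inj₂ j≡k

    u-adj : ∀ j → Adj u (q j) ⇔ (toℕ j ≡ 0 ⊎ toℕ j ≡ k)
    u-adj j = mk⇔ (ends j) λ
      { (inj₁ e) → subst (Adj u ∘ q) (toℕ-injective (sym e)) u~q₀
      ; (inj₂ e) → subst (Adj u ∘ q) (toℕ-injective (trans (toℕ-fromℕ k) (sym e))) u~qₖ }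

    ∷-adj : ∀ i j → Adj ((u ∷ q) i) ((u ∷ q) j) ⇔ CycAdj G i j
    ∷-adj zero    zero    = mk⇔ (λ u~u → contradiction u~u irrefl) λ
      { (inj₁ (inj₁ ())) ; (inj₁ (inj₂ ())) ; (inj₂ (inj₁ (_ , ()))) ; (inj₂ (inj₂ (_ , ()))) }
    ∷-adj zero    (suc j) = ⇔-sym CycAdj-zero-suc ⇔-∘ u-adj j
    ∷-adj (suc i) zero    = CycAdj-comm ⇔-∘ (∷-adj zero (suc i) ⇔-∘ Adj-comm)
    ∷-adj (suc i) (suc j) = ⇔-sym CycAdj-suc ⇔-∘ q-adj i j

  module _ {m} {p : Fin (suc (suc m)) → Fin n} (p-path : IsInducedPath G p) where

    start-nonadjacent : ∀ i → 2 ≤ toℕ i → ¬ Adj (p zero) (p i)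
    start-nonadjacent i 2≤i p₀~pᵢ with Equivalence.to (proj₂ p-path zero i) p₀~pᵢ
    ... | inj₁ i≡1 = <-irrefl (sym i≡1) 2≤i
    ... | inj₂ ()

    start-neighbour-off-path : ∀ {u} → Adj (p zero) u → u ≢ p (suc zero) → ∀ i → p i ≢ u
    start-neighbour-off-path p₀~u u≢p₁ i refl with Equivalence.to (proj₂ p-path zero i) p₀~u
    ... | inj₁ i≡1 = u≢p₁ (cong p (toℕ-injective i≡1))
    ... | inj₂ ()

    record EarliestNeighbour (x : Fin n) : Set where
      field
        index    : Fin (suc (suc m))
        2≤index  : 2 ≤ toℕ index
        adjacent : Adj x (p index)
        earliest : ∀ l → 0 < toℕ l → toℕ l < toℕ index → ¬ Adj x (p l)

    earliestNeighbour : ∀ {x} → ¬ Adj x (p (suc zero)) →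
                        HasNbrInPathMinus G p (p zero) x → EarliestNeighbour x
    earliestNeighbour {x} x≁p₁ (i , pᵢ≢p₀ , x~pᵢ)
      with least-witness (λ l → 0 < toℕ l × Adj x (p l))
                         (λ l → (0 <? toℕ l) ×-dec adj? x (p l))
                         (i , ≤∧≢⇒< z≤n (pᵢ≢p₀ ∘ cong p ∘ sym) , x~pᵢ)
    ... | j , (0<j , x~pⱼ) , before = record
      { index    = j
      ; 2≤index  = beyond-p₁ j 0<j x~pⱼ
      ; adjacent = x~pⱼ
      ; earliest = λ l 0<l l<j x~pₗ → before l l<j (0<l , x~pₗ)
      }
      where
      beyond-p₁ : ∀ j → 0 < toℕ j → Adj x (p j) → 2 ≤ toℕ j
      beyond-p₁ (suc zero)    _ x~p₁ = contradiction x~p₁ x≁p₁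
      beyond-p₁ (suc (suc _)) _ _    = s≤s (s≤s z≤n)

    open EarliestNeighbour

    clock-from-earliest-neighbours :
      ∀ {x v} → Adj (p zero) x → Adj (p zero) v →
      x ≢ p (suc zero) → v ≢ p (suc zero) → x ≢ v →
      (X : EarliestNeighbour x) (V : EarliestNeighbour v) →
      toℕ (index X) ≤ toℕ (index V) → Clock G
    clock-from-earliest-neighbours {x} {v} p₀~x p₀~v x≢p₁ v≢p₁ x≢v X V i≤j = record
      { k = suc (suc (toℕ j)) ; c = v ∷ q ; hole = hole ; w = x ; w∉C = x∉hole
      ; i = suc zero ; j = suc i′ ; i≢j = i′≢zero ∘ Fin-suc-injective
      ; wci = Adj-sym p₀~x
      ; wcj = subst (Adj x) (sym qᵢ′≡pᵢ) (adjacent X)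
      ; nonadj = subst (¬_ ∘ Adj (p zero)) (sym qᵢ′≡pᵢ) (start-nonadjacent i (2≤index X))
      }
      where
      i j : Fin (suc (suc m))
      i = index X
      j = index V

      q : Fin (suc (toℕ j)) → Fin n
      q l = p (inject≤ l (toℕ<n j))

      q-toℕ : ∀ l {i} → toℕ l ≡ toℕ i → q l ≡ p i
      q-toℕ l e = cong p (toℕ-injective (trans (toℕ-inject≤ l _) e))

      hole : IsHole G (v ∷ q)
      hole = attach-isHole (prefix-isInducedPath (toℕ<n j) p-path) (2≤index V)
        (λ l → start-neighbour-off-path p₀~v v≢p₁ (inject≤ l _))
        (Adj-sym p₀~v)
        (subst (Adj v) (sym (q-toℕ (fromℕ (toℕ j)) (toℕ-fromℕ _))) (adjacent V))
        (λ l 0<l l<j → earliest V (inject≤ l _)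
                         (subst (0 <_) (sym (toℕ-inject≤ l _)) 0<l)
                         (subst (_< toℕ j) (sym (toℕ-inject≤ l _)) l<j))

      x∉hole : ∀ l → (v ∷ q) l ≢ x
      x∉hole zero    = x≢v ∘ sym
      x∉hole (suc l) = start-neighbour-off-path p₀~x x≢p₁ _

      i′ : Fin (suc (toℕ j))
      i′ = fromℕ< (s≤s i≤j)

      qᵢ′≡pᵢ : q i′ ≡ p i
      qᵢ′≡pᵢ = q-toℕ i′ (toℕ-fromℕ< _)

      i′≢zero : zero ≢ i′
      i′≢zero e with subst (2 ≤_) (trans (sym (toℕ-fromℕ< (s≤s i≤j))) (cong toℕ (sym e))) (2≤index X)
      ... | ()

    HasNbrInPathMinus? : ∀ a x → Dec (HasNbrInPathMinus G p a x)
    HasNbrInPathMinus? a x = any? λ i → ¬? (p i ≟ a) ×-dec adj? x (p i)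

    start-neighbours-not-both-attached : ClockFree G → ∀ {x v} → Adj (p zero) x → Adj (p zero) v →
      x ≢ p (suc zero) → v ≢ p (suc zero) → x ≢ v →
      ¬ Adj x (p (suc zero)) → ¬ Adj v (p (suc zero)) →
      ¬ HasNbrInPathMinus G p (p zero) x ⊎ ¬ HasNbrInPathMinus G p (p zero) v
    start-neighbours-not-both-attached clock-free {x} {v} p₀~x p₀~v x≢p₁ v≢p₁ x≢v x≁p₁ v≁p₁
      with HasNbrInPathMinus? (p zero) x | HasNbrInPathMinus? (p zero) v
    ... | no ¬x-beyond | _            = inj₁ ¬x-beyond
    ... | yes _        | no ¬v-beyond = inj₂ ¬v-beyond
    ... | yes x-beyond | yes v-beyond = contradiction clock clock-free
      where
      X : EarliestNeighbour x
      X = earliestNeighbour x≁p₁ x-beyond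
      V : EarliestNeighbour v
      V = earliestNeighbour v≁p₁ v-beyond
      clock : Clock G
      clock with ≤-total (toℕ (index X)) (toℕ (index V))
      ... | inj₁ i≤j = clock-from-earliest-neighbours p₀~x p₀~v x≢p₁ v≢p₁ x≢v X V i≤j
      ... | inj₂ j≤i = clock-from-earliest-neighbours p₀~v p₀~x v≢p₁ x≢p₁ (x≢v ∘ sym) V X j≤i

lemma4p4 : ∀ {n : ℕ} (G : Graph n) → ClockFree G →
    ∀ (m : ℕ) (p : Fin (suc (suc m)) → Fin n) → IsInducedPath G p →
    ∀ (a y : Fin n) →
    ((a ≡ p zero × y ≡ p (suc zero)) ⊎ (a ≡ p (fromℕ (suc m)) × y ≡ p (inject₁ (fromℕ m)))) →
    ∀ (x v : Fin n) → Graph.Adj G a x → Graph.Adj G a v →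
    x ≢ y → y ≢ v → x ≢ v →
    ¬ Graph.Adj G x y → ¬ Graph.Adj G y v → ¬ Graph.Adj G x v →
    ¬ HasNbrInPathMinus G p a x ⊎ ¬ HasNbrInPathMinus G p a v
lemma4p4 G clock-free m p p-path a y (inj₁ (refl , refl)) x v a~x a~v x≢y y≢v x≢v x≁y y≁v _ =
  start-neighbours-not-both-attached G p-path clock-free a~x a~v x≢y (y≢v ∘ sym) x≢v x≁y (y≁v ∘ Graph.sym G)
-- p ∘ opposite starts with p (fromℕ (suc m)) and p (inject₁ (fromℕ m)) by computation.
lemma4p4 G clock-free m p p-path a y (inj₂ (refl , refl)) x v a~x a~v x≢y y≢v x≢v x≁y y≁v _ =
  Sum.map (_∘ HasNbrInPathMinus-reverse G) (_∘ HasNbrInPathMinus-reverse G)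
    (start-neighbours-not-both-attached G (reverse-isInducedPath G p-path) clock-free
       a~x a~v x≢y (y≢v ∘ sym) x≢v x≁y (y≁v ∘ Graph.sym G))
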